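{- For every $k\ge 1$, $\min\left\{\omega\big(G_k^{(1)}\big),\ \alpha\big(G_k^{(0)}\big)\right\} \ge 2^{3^k(1-o_k(1))}$, where $o_k(1)\to0$ as $k\to\infty$. Equivalently, the matrices $A_k$ have principal minors which are all-zeros and all-ones, each of order $2^{3^k(1-o_k(1))}$.
   Context: $\mathrm{NAE}:\{0,1\}^3\to\{0,1\}$ is $0$ if all three inputs are equal and $1$ otherwise. $\mathrm{NAE}^1=\mathrm{NAE}$, and for $k>1$, $\mathrm{NAE}^k(x) = \mathrm{NAE}\big(\mathrm{NAE}^{k-1}(x_1,\dots,x_{3^{k-1}}),\mathrm{NAE}^{k-1}(x_{3^{k-1}+1},\dots,x_{2\cdot3^{k-1}}),\mathrm{NAE}^{k-1}(x_{2\cdot3^{k-1}+1},\dots,x_{3^k})\big)$ for $x\in\{0,1\}^{3^k}$. $A_k$ is the $2^{3^k}\times 2^{3^k}$ binary matrix indexed by $\{0,1\}^{3^k}$ with $(A_k)_{x,y} = \mathrm{NAE}^k(x\wedge y)$, where $\wedge$ is coordinatewise AND. For $b\in\{0,1\}$, $G_k^{(b)}$ is the graph with vertex set $\{x\in\{0,1\}^{3^k}: \mathrm{NAE}^k(x)=b\}$ in which distinct $x,y$ are adjacent iff $\mathrm{NAE}^k(x\wedge y)=1$. $\omega$ and $\alpha$ denote clique and independence number. -}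

module Defs where

open import Data.Bool using (Bool; true; false; _∧_; _∨_; _xor_)
open import Data.Nat using (ℕ; zero; suc; _^_; _*_; _≤_)
open import Data.Vec using (Vec; []; _∷_; take; drop; zipWith)
open import Data.List using (List; length)
open import Data.List.Relation.Unary.All using (All)
open import Data.List.Relation.Unary.AllPairs using (AllPairs)
open import Data.List.Relation.Unary.Unique.Propositional using (Unique)
open import Data.Product using (_×_; ∃-syntax)
open import Relation.Binary.PropositionalEquality using (_≡_)

nae : Bool → Bool → Bool → Bool
nae a b c = (a xor b) ∨ (b xor c)

-- Iterated NAE on {0,1}^(3^k).  NAE^0 is the identity on one bit
-- (consistent with the recursion; NAE^1 = NAE).  Blocks are the first,
-- second and third consecutive thirds of the input.
naeIter : (k : ℕ) → Vec Bool (3 ^ k) → Bool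
naeIter zero (x ∷ []) = x
naeIter (suc k) xs =
  nae (naeIter k (take m xs))
      (naeIter k (take m (drop m xs)))
      (naeIter k (take m (drop m (drop m xs))))
  where m = 3 ^ k

_⊓_ : ∀ {n} → Vec Bool n → Vec Bool n → Vec Bool n
x ⊓ y = zipWith _∧_ x y

-- adjacency value NAE^k(x ∧ y) (the entry (A_k)_{x,y})
edgeVal : (k : ℕ) → Vec Bool (3 ^ k) → Vec Bool (3 ^ k) → Bool
edgeVal k x y = naeIter k (x ⊓ y)

IsCliqueG1 : (k : ℕ) → List (Vec Bool (3 ^ k)) → Set
IsCliqueG1 k S =
  Unique S × All (λ x → naeIter k x ≡ true) S
           × AllPairs (λ x y → edgeVal k x y ≡ true) S

IsIndepG0 : (k : ℕ) → List (Vec Bool (3 ^ k)) → Set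
IsIndepG0 k T =
  Unique T × All (λ x → naeIter k x ≡ false) T
           × AllPairs (λ x y → edgeVal k x y ≡ false) T

-- the lower bound |S| ≥ 2^(3^k (1 - 1/(m+1))), written in ℕ as
-- 2^(3^k · m) ≤ |S|^(m+1)
LargeClique : (k m : ℕ) → Set
LargeClique k m = ∃[ S ] (IsCliqueG1 k S × 2 ^ (3 ^ k * m) ≤ length S ^ suc m)

LargeIndep : (k m : ℕ) → Set
LargeIndep k m = ∃[ T ] (IsIndepG0 k T × 2 ^ (3 ^ k * m) ≤ length T ^ suc m)

{-# OPTIONS --safe #-}
module Submission where

-- Let S_k = cliqueSet k and T_k = indepSet k. Splitting vectors of length 3^(k+1) into three
-- blocks, NAE^(k+1)(x ∧ y) is the NAE of the three blockwise values, so A_(k+1) is constantly 1 on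
-- S_(k+1) = S_k × {0,1}^(3^k) × T_k, since NAE(1, ·, 0) = 1, and constantly 0 on
-- T_(k+1) = S_k × S_k × S_k, since NAE(1, 1, 1) = 0. The diagonal is included, so S_k is a clique
-- of G_k^(1) and T_k an independent set of G_k^(0).
-- Writing |S_k| = 2^(3^k - d_k) and |T_k| = 2^(3^k - e_k), the deficits satisfy d_(k+1) = d_k + e_k
-- and e_(k+1) = 3 d_k, so the potential 2 d_k + e_k grows by a factor of at most 5/2 per level.
-- By Bernoulli, (6/5)^k ≥ 1 + k/5, hence (m+1) · 3 · (5/2)^k ≤ 3^k once k ≥ 15 (m+1); then both
-- deficits are at most 3^k/(m+1), i.e. |S_k|, |T_k| ≥ 2^(3^k · m/(m+1)).

open import Defs
open import Data.Nat using (ℕ; _≤_)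
open import Data.Product using (_×_; ∃-syntax)

open import Data.Bool using (Bool; true; false; _∧_)
open import Data.Bool.Properties using (∧-idem)
open import Data.List as List
  using (List; []; _∷_; [_]; length; cartesianProductWith; cartesianProduct)
open import Data.List.Properties using (length-++; length-map)
open import Data.List.Membership.Propositional using (_∈_)
open import Data.List.Membership.Propositional.Properties
  using (∈-cartesianProductWith⁻; ∈-cartesianProduct⁻)
open import Data.List.Relation.Unary.All as All using (All; []; _∷_)
open import Data.List.Relation.Unary.AllPairs using (AllPairs; []; _∷_)
open import Data.List.Relation.Unary.Any using (here; there)
open import Data.List.Relation.Unary.Unique.Propositional using (Unique)
open import Data.List.Relation.Unary.Unique.Propositional.Properties
  using (cartesianProductWith⁺; cartesianProduct⁺)
open import Data.Nat using (zero; suc; _+_; _*_; _^_)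
open import Data.Nat.Properties
  using ( *-commutativeSemigroup; ≤-reflexive; ≤-refl; ≤-trans; module ≤-Reasoning
        ; +-identityʳ; +-comm; *-identityʳ; *-comm; *-assoc; *-suc
        ; +-mono-≤; +-monoʳ-≤; *-monoˡ-≤; *-monoʳ-≤; *-cancelˡ-≤; *-cancelʳ-≤
        ; ^-distribˡ-+-*; ^-*-assoc; ^-monoˡ-≤; ^-monoʳ-≤; m^n≢0
        ; n≤1+n; m≤m+n; m≤n+m; m≤n*m )
open import Data.Nat.Tactic.RingSolver using (solve-∀)
open import Algebra.Properties.CommutativeSemigroup *-commutativeSemigroup
  using (interchange; x∙yz≈y∙xz; xy∙z≈y∙xz)
open import Data.Product using (_,_; uncurry)
open import Data.Vec using (Vec; []; _∷_; _++_; take; drop)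
open import Data.Vec.Properties using (++-injective; ∷-injective; zipWith-++; zipWith-idem)
open import Function using (_∘_)
open import Relation.Binary.PropositionalEquality
  using (_≡_; refl; sym; trans; cong; cong₂; module ≡-Reasoning)

module _ {a} {A : Set a} where

  take-++ : ∀ {m n} (xs : Vec A m) (ys : Vec A n) → take m (xs ++ ys) ≡ xs
  take-++ []       ys = refl
  take-++ (x ∷ xs) ys = cong (x ∷_) (take-++ xs ys)

  drop-++ : ∀ {m n} (xs : Vec A m) (ys : Vec A n) → drop m (xs ++ ys) ≡ ys
  drop-++ []       ys = refl
  drop-++ (x ∷ xs) ys = drop-++ xs ys

  concat₃ : ∀ {n} → Vec A n → Vec A n → Vec A n → Vec A (3 * n)
  concat₃ x y z = x ++ y ++ z ++ []

  concat₃-injective : ∀ {n} {x y z u v w : Vec A n} →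
                      concat₃ x y z ≡ concat₃ u v w → x ≡ u × y ≡ v × z ≡ w
  concat₃-injective {x = x} {y} {z} {u} {v} {w} eq
    with refl , eq₁ ← ++-injective x u eq
    with refl , eq₂ ← ++-injective y v eq₁
    with refl , _   ← ++-injective z w eq₂
    = refl , refl , refl

module _ {a b c} {A : Set a} {B : Set b} {C : Set c} where

  length-cartesianProductWith : ∀ (f : A → B → C) xs ys →
                                length (cartesianProductWith f xs ys) ≡ length xs * length ys
  length-cartesianProductWith f []       ys = refl
  length-cartesianProductWith f (x ∷ xs) ys = begin
    length (List.map (f x) ys List.++ cartesianProductWith f xs ys)
      ≡⟨ length-++ (List.map (f x) ys) ⟩
    length (List.map (f x) ys) + length (cartesianProductWith f xs ys)
      ≡⟨ cong₂ _+_ (length-map (f x) ys) (length-cartesianProductWith f xs ys) ⟩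
    length ys + length xs * length ys ∎
    where open ≡-Reasoning

module _ {a r} {A : Set a} {R : A → A → Set r} where

  allPairs-tabulate : ∀ {xs} → (∀ {x y} → x ∈ xs → y ∈ xs → R x y) → AllPairs R xs
  allPairs-tabulate {[]}     _ = []
  allPairs-tabulate {x ∷ xs} h =
    All.tabulate (h (here refl) ∘ there) ∷ allPairs-tabulate (λ x∈ y∈ → h (there x∈) (there y∈))

module _ {a} {A : Set a} where

  vectors : List A → (n : ℕ) → List (Vec A n)
  vectors xs zero    = [ [] ]
  vectors xs (suc n) = cartesianProductWith _∷_ xs (vectors xs n)

  vectors-unique : ∀ {xs} → Unique xs → ∀ n → Unique (vectors xs n)
  vectors-unique u zero    = [] ∷ []
  vectors-unique u (suc n) = cartesianProductWith⁺ _∷_ ∷-injective u (vectors-unique u n)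

  length-vectors : ∀ xs n → length (vectors xs n) ≡ length xs ^ n
  length-vectors xs zero    = refl
  length-vectors xs (suc n) =
    trans (length-cartesianProductWith _∷_ xs (vectors xs n))
          (cong (length xs *_) (length-vectors xs n))

  product₃ : ∀ {n} → List (Vec A n) → List (Vec A n) → List (Vec A n) → List (Vec A (3 * n))
  product₃ xs ys zs = cartesianProductWith (uncurry ∘ concat₃) xs (cartesianProduct ys zs)

  product₃-unique : ∀ {n} {xs ys zs : List (Vec A n)} →
                    Unique xs → Unique ys → Unique zs → Unique (product₃ xs ys zs)
  product₃-unique uxs uys uzs =
    cartesianProductWith⁺ (uncurry ∘ concat₃) uncurried-injective uxs (cartesianProduct⁺ uys uzs)
    where
    uncurried-injective : ∀ {x u} {yz vw} →
                          uncurry (concat₃ x) yz ≡ uncurry (concat₃ u) vw → x ≡ u × yz ≡ vw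
    uncurried-injective {x} {u} {y , z} {v , w} eq
      with refl , refl , refl ← concat₃-injective {x = x} {y} {z} {u} {v} {w} eq = refl , refl

  ∈-product₃⁻ : ∀ {n} {xs ys zs : List (Vec A n)} {s} → s ∈ product₃ xs ys zs →
                ∃[ x ] ∃[ y ] ∃[ z ] (x ∈ xs × y ∈ ys × z ∈ zs × s ≡ concat₃ x y z)
  ∈-product₃⁻ {xs = xs} {ys} {zs} s∈
    with x , (y , z) , x∈ , yz∈ , refl
           ← ∈-cartesianProductWith⁻ (uncurry ∘ concat₃) xs (cartesianProduct ys zs) s∈
    with y∈ , z∈ ← ∈-cartesianProduct⁻ ys zs yz∈
    = x , y , z , x∈ , y∈ , z∈ , refl

  length-product₃ : ∀ {n} (xs ys zs : List (Vec A n)) →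
                    length (product₃ xs ys zs) ≡ length xs * (length ys * length zs)
  length-product₃ xs ys zs =
    trans (length-cartesianProductWith (uncurry ∘ concat₃) xs (cartesianProduct ys zs))
          (cong (length xs *_) (length-cartesianProductWith _,_ ys zs))

  product₃-deficit : ∀ {n r} (xs ys zs : List (Vec A n)) d e f →
                     length xs * r ^ d ≡ r ^ n → length ys * r ^ e ≡ r ^ n →
                     length zs * r ^ f ≡ r ^ n →
                     length (product₃ xs ys zs) * r ^ (d + (e + f)) ≡ r ^ (3 * n)
  product₃-deficit {n} {r} xs ys zs d e f xs-deficit ys-deficit zs-deficit = begin
    length (product₃ xs ys zs) * r ^ (d + (e + f))
      ≡⟨ cong₂ _*_ (length-product₃ xs ys zs)
                   (trans (^-distribˡ-+-* r d (e + f)) (cong (r ^ d *_) (^-distribˡ-+-* r e f))) ⟩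
    (length xs * (length ys * length zs)) * (r ^ d * (r ^ e * r ^ f))
      ≡⟨ interchange (length xs) _ (r ^ d) _ ⟩
    (length xs * r ^ d) * ((length ys * length zs) * (r ^ e * r ^ f))
      ≡⟨ cong (length xs * r ^ d *_) (interchange (length ys) (length zs) (r ^ e) (r ^ f)) ⟩
    (length xs * r ^ d) * ((length ys * r ^ e) * (length zs * r ^ f))
      ≡⟨ cong₂ _*_ xs-deficit (cong₂ _*_ ys-deficit zs-deficit) ⟩
    r ^ n * (r ^ n * r ^ n)
      ≡⟨ cong (λ t → r ^ n * (r ^ n * t)) (sym (*-identityʳ (r ^ n))) ⟩
    (r ^ n) ^ 3
      ≡⟨ ^-*-assoc r n 3 ⟩
    r ^ (n * 3)
      ≡⟨ cong (r ^_) (*-comm n 3) ⟩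
    r ^ (3 * n) ∎
    where open ≡-Reasoning

^-distrib-* : ∀ a b n → (a * b) ^ n ≡ a ^ n * b ^ n
^-distrib-* a b zero    = refl
^-distrib-* a b (suc n) =
  trans (cong (a * b *_) (^-distrib-* a b n)) (interchange a b (a ^ n) (b ^ n))

bernoulli : ∀ a k → (a + k) * a ^ k ≤ a * suc a ^ k
bernoulli a zero    = ≤-reflexive (cong (_* 1) (+-identityʳ a))
bernoulli a (suc k) = begin
  (a + suc k) * (a * a ^ k)            ≡⟨ split a k (a ^ k) ⟩
  a * ((a + k) * a ^ k) + a * a ^ k    ≤⟨ +-mono-≤ (*-monoʳ-≤ a (bernoulli a k))
                                                   (*-monoʳ-≤ a (^-monoˡ-≤ k (n≤1+n a))) ⟩
  a * (a * suc a ^ k) + a * suc a ^ k  ≡⟨ merge a (suc a ^ k) ⟩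
  a * (suc a * suc a ^ k)              ∎
  where
  open ≤-Reasoning
  split : ∀ a k p → (a + suc k) * (a * p) ≡ a * ((a + k) * p) + a * p
  split = solve-∀
  merge : ∀ a q → a * (a * q) + a * q ≡ a * (suc a * q)
  merge = solve-∀

2^k*x≤c*5^k⇒x≤3^k : ∀ {k x} c → 2 ^ k * x ≤ c * 5 ^ k → 5 * c ≤ 5 + k → x ≤ 3 ^ k
2^k*x≤c*5^k⇒x≤3^k {k} {x} c bound k-large =
  *-cancelˡ-≤ 5 (*-cancelˡ-≤ (2 ^ k) {{m^n≢0 2 k}} (begin
    2 ^ k * (5 * x)      ≡⟨ x∙yz≈y∙xz (2 ^ k) 5 x ⟩
    5 * (2 ^ k * x)      ≤⟨ *-monoʳ-≤ 5 bound ⟩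
    5 * (c * 5 ^ k)      ≡⟨ *-assoc 5 c (5 ^ k) ⟨
    5 * c * 5 ^ k        ≤⟨ *-monoˡ-≤ (5 ^ k) k-large ⟩
    (5 + k) * 5 ^ k      ≤⟨ bernoulli 5 k ⟩
    5 * 6 ^ k            ≡⟨ cong (5 *_) (^-distrib-* 2 3 k) ⟩
    5 * (2 ^ k * 3 ^ k)  ≡⟨ x∙yz≈y∙xz 5 (2 ^ k) (3 ^ k) ⟩
    2 ^ k * (5 * 3 ^ k)  ∎))
  where open ≤-Reasoning

deficit-small⇒length-large : ∀ {a} {A : Set a} {n d} m (L : List A) →
                             length L * 2 ^ d ≡ 2 ^ n → suc m * d ≤ n →
                             2 ^ (n * m) ≤ length L ^ suc m
deficit-small⇒length-large {n = n} {d} m L deficit small =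
  *-cancelʳ-≤ _ _ (2 ^ (d * suc m)) {{m^n≢0 2 (d * suc m)}} (begin
    2 ^ (n * m) * 2 ^ (d * suc m)       ≡⟨ ^-distribˡ-+-* 2 (n * m) (d * suc m) ⟨
    2 ^ (n * m + d * suc m)             ≤⟨ ^-monoʳ-≤ 2 (+-monoʳ-≤ (n * m) d[m+1]≤n) ⟩
    2 ^ (n * m + n)                     ≡⟨ cong (2 ^_) (+-comm (n * m) n) ⟩
    2 ^ (n + n * m)                     ≡⟨ cong (2 ^_) (*-suc n m) ⟨
    2 ^ (n * suc m)                     ≡⟨ ^-*-assoc 2 n (suc m) ⟨
    (2 ^ n) ^ suc m                     ≡⟨ cong (_^ suc m) deficit ⟨
    (length L * 2 ^ d) ^ suc m          ≡⟨ ^-distrib-* (length L) (2 ^ d) (suc m) ⟩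
    length L ^ suc m * (2 ^ d) ^ suc m  ≡⟨ cong (length L ^ suc m *_) (^-*-assoc 2 d (suc m)) ⟩
    length L ^ suc m * 2 ^ (d * suc m)  ∎)
  where
  open ≤-Reasoning
  d[m+1]≤n : d * suc m ≤ n
  d[m+1]≤n = ≤-trans (≤-reflexive (*-comm d (suc m))) small

⊓-idem : ∀ {n} (x : Vec Bool n) → x ⊓ x ≡ x
⊓-idem = zipWith-idem ∧-idem

⊓-concat₃ : ∀ {n} (x y z u v w : Vec Bool n) →
            concat₃ x y z ⊓ concat₃ u v w ≡ concat₃ (x ⊓ u) (y ⊓ v) (z ⊓ w)
⊓-concat₃ x y z u v w
  rewrite zipWith-++ _∧_ x (y ++ z ++ []) u (v ++ w ++ [])
        | zipWith-++ _∧_ y (z ++ []) v (w ++ [])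
        | zipWith-++ _∧_ z [] w [] = refl

naeIter-concat₃ : ∀ k (x y z : Vec Bool (3 ^ k)) →
                  naeIter (suc k) (concat₃ x y z) ≡ nae (naeIter k x) (naeIter k y) (naeIter k z)
naeIter-concat₃ k x y z
  rewrite drop-++ x (y ++ z ++ []) | drop-++ y (z ++ [])
        | take-++ x (y ++ z ++ []) | take-++ y (z ++ []) | take-++ z [] = refl

edgeVal-concat₃ : ∀ k (x y z u v w : Vec Bool (3 ^ k)) →
                  edgeVal (suc k) (concat₃ x y z) (concat₃ u v w) ≡
                  nae (edgeVal k x u) (edgeVal k y v) (edgeVal k z w)
edgeVal-concat₃ k x y z u v w =
  trans (cong (naeIter (suc k)) (⊓-concat₃ x y z u v w)) (naeIter-concat₃ k (x ⊓ u) (y ⊓ v) (z ⊓ w))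

nae-true-any-false : ∀ {p q r} → p ≡ true → r ≡ false → nae p q r ≡ true
nae-true-any-false {q = true}  refl refl = refl
nae-true-any-false {q = false} refl refl = refl

nae-true-true-true : ∀ {p q r} → p ≡ true → q ≡ true → r ≡ true → nae p q r ≡ false
nae-true-true-true refl refl refl = refl

Monochromatic : (k : ℕ) → Bool → List (Vec Bool (3 ^ k)) → Set
Monochromatic k b L = ∀ {x y} → x ∈ L → y ∈ L → edgeVal k x y ≡ b

monochromatic-diagonal : ∀ k {b L} → Monochromatic k b L → All (λ x → naeIter k x ≡ b) L
monochromatic-diagonal k mono =
  All.tabulate (λ {x} x∈ → trans (cong (naeIter k) (sym (⊓-idem x))) (mono x∈ x∈))

monochromatic⇒cliqueG1 : ∀ k {L} → Unique L → Monochromatic k true L → IsCliqueG1 k L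
monochromatic⇒cliqueG1 k unique mono =
  unique , monochromatic-diagonal k mono , allPairs-tabulate mono

monochromatic⇒indepG0 : ∀ k {L} → Unique L → Monochromatic k false L → IsIndepG0 k L
monochromatic⇒indepG0 k unique mono =
  unique , monochromatic-diagonal k mono , allPairs-tabulate mono

product₃-monochromatic : ∀ k {b} {xs ys zs : List (Vec Bool (3 ^ k))} →
  (∀ {x y z u v w} → x ∈ xs → y ∈ ys → z ∈ zs → u ∈ xs → v ∈ ys → w ∈ zs →
     nae (edgeVal k x u) (edgeVal k y v) (edgeVal k z w) ≡ b) →
  Monochromatic (suc k) b (product₃ xs ys zs)
product₃-monochromatic k h s∈ t∈ with ∈-product₃⁻ {n = 3 ^ k} s∈ | ∈-product₃⁻ {n = 3 ^ k} t∈
... | x , y , z , x∈ , y∈ , z∈ , refl | u , v , w , u∈ , v∈ , w∈ , refl =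
  trans (edgeVal-concat₃ k x y z u v w) (h x∈ y∈ z∈ u∈ v∈ w∈)

bits : List Bool
bits = true ∷ false ∷ []

bits-unique : Unique bits
bits-unique = ((λ ()) ∷ []) ∷ [] ∷ []

cliqueSet indepSet : (k : ℕ) → List (Vec Bool (3 ^ k))
cliqueSet zero    = [ true ∷ [] ]
cliqueSet (suc k) = product₃ (cliqueSet k) (vectors bits (3 ^ k)) (indepSet k)
indepSet zero    = [ false ∷ [] ]
indepSet (suc k) = product₃ (cliqueSet k) (cliqueSet k) (cliqueSet k)

cliqueSet-unique : ∀ k → Unique (cliqueSet k)
indepSet-unique  : ∀ k → Unique (indepSet k)
cliqueSet-unique zero    = [] ∷ []
cliqueSet-unique (suc k) =
  product₃-unique (cliqueSet-unique k) (vectors-unique bits-unique (3 ^ k)) (indepSet-unique k)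
indepSet-unique zero    = [] ∷ []
indepSet-unique (suc k) =
  product₃-unique (cliqueSet-unique k) (cliqueSet-unique k) (cliqueSet-unique k)

cliqueSet-monochromatic : ∀ k → Monochromatic k true (cliqueSet k)
indepSet-monochromatic  : ∀ k → Monochromatic k false (indepSet k)
cliqueSet-monochromatic zero (here refl) (here refl) = refl
cliqueSet-monochromatic (suc k) =
  product₃-monochromatic k {ys = vectors bits (3 ^ k)} λ x∈ _ z∈ u∈ _ w∈ →
    nae-true-any-false (cliqueSet-monochromatic k x∈ u∈) (indepSet-monochromatic k z∈ w∈)
indepSet-monochromatic zero (here refl) (here refl) = refl
indepSet-monochromatic (suc k) =
  product₃-monochromatic k λ x∈ y∈ z∈ u∈ v∈ w∈ →
    nae-true-true-true (cliqueSet-monochromatic k x∈ u∈) (cliqueSet-monochromatic k y∈ v∈)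
                       (cliqueSet-monochromatic k z∈ w∈)

cliqueDeficit indepDeficit : ℕ → ℕ
cliqueDeficit zero    = 1
cliqueDeficit (suc k) = cliqueDeficit k + indepDeficit k
indepDeficit zero    = 1
indepDeficit (suc k) = cliqueDeficit k + (cliqueDeficit k + cliqueDeficit k)

cliqueSet-deficit : ∀ k → length (cliqueSet k) * 2 ^ cliqueDeficit k ≡ 2 ^ 3 ^ k
indepSet-deficit  : ∀ k → length (indepSet k) * 2 ^ indepDeficit k ≡ 2 ^ 3 ^ k
cliqueSet-deficit zero    = refl
cliqueSet-deficit (suc k) =
  product₃-deficit (cliqueSet k) (vectors bits (3 ^ k)) (indepSet k)
                   (cliqueDeficit k) 0 (indepDeficit k)
                   (cliqueSet-deficit k)
                   (trans (*-identityʳ _) (length-vectors bits (3 ^ k)))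
                   (indepSet-deficit k)
indepSet-deficit zero    = refl
indepSet-deficit (suc k) =
  product₃-deficit (cliqueSet k) (cliqueSet k) (cliqueSet k)
                   (cliqueDeficit k) (cliqueDeficit k) (cliqueDeficit k)
                   (cliqueSet-deficit k) (cliqueSet-deficit k) (cliqueSet-deficit k)

potential : ℕ → ℕ
potential k = 2 * cliqueDeficit k + indepDeficit k

potential-step : ∀ k → 2 * potential (suc k) ≤ 5 * potential k
potential-step k =
  ≤-trans (m≤m+n _ (indepDeficit k)) (≤-reflexive (identity (cliqueDeficit k) (indepDeficit k)))
  where
  identity : ∀ d e → 2 * (2 * (d + e) + (d + (d + d))) + e ≡ 5 * (2 * d + e)
  identity = solve-∀

potential-bound : ∀ k → 2 ^ k * potential k ≤ 3 * 5 ^ k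
potential-bound zero    = ≤-refl
potential-bound (suc k) = begin
  2 * 2 ^ k * potential (suc k)    ≡⟨ xy∙z≈y∙xz 2 (2 ^ k) _ ⟩
  2 ^ k * (2 * potential (suc k))  ≤⟨ *-monoʳ-≤ (2 ^ k) (potential-step k) ⟩
  2 ^ k * (5 * potential k)        ≡⟨ x∙yz≈y∙xz (2 ^ k) 5 _ ⟩
  5 * (2 ^ k * potential k)        ≤⟨ *-monoʳ-≤ 5 (potential-bound k) ⟩
  5 * (3 * 5 ^ k)                  ≡⟨ x∙yz≈y∙xz 5 3 (5 ^ k) ⟩
  3 * (5 * 5 ^ k)                  ∎
  where open ≤-Reasoning

potential-eventually-small : ∀ m k → 15 * suc m ≤ k → suc m * potential k ≤ 3 ^ k
potential-eventually-small m k k-large = 2^k*x≤c*5^k⇒x≤3^k (3 * suc m) bound 5[3[m+1]]≤5+k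
  where
  open ≤-Reasoning
  bound : 2 ^ k * (suc m * potential k) ≤ 3 * suc m * 5 ^ k
  bound = begin
    2 ^ k * (suc m * potential k)  ≡⟨ x∙yz≈y∙xz (2 ^ k) (suc m) _ ⟩
    suc m * (2 ^ k * potential k)  ≤⟨ *-monoʳ-≤ (suc m) (potential-bound k) ⟩
    suc m * (3 * 5 ^ k)            ≡⟨ x∙yz≈y∙xz (suc m) 3 (5 ^ k) ⟩
    3 * (suc m * 5 ^ k)            ≡⟨ *-assoc 3 (suc m) (5 ^ k) ⟨
    3 * suc m * 5 ^ k              ∎
  5[3[m+1]]≤5+k : 5 * (3 * suc m) ≤ 5 + k
  5[3[m+1]]≤5+k = ≤-trans (≤-reflexive (sym (*-assoc 5 3 (suc m)))) (≤-trans k-large (m≤n+m k 5))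

deficits-eventually-small : ∀ m k → 15 * suc m ≤ k →
                            suc m * cliqueDeficit k ≤ 3 ^ k × suc m * indepDeficit k ≤ 3 ^ k
deficits-eventually-small m k k-large =
  ≤-trans (*-monoʳ-≤ (suc m) cliqueDeficit≤potential) (potential-eventually-small m k k-large) ,
  ≤-trans (*-monoʳ-≤ (suc m) indepDeficit≤potential) (potential-eventually-small m k k-large)
  where
  cliqueDeficit≤potential : cliqueDeficit k ≤ potential k
  cliqueDeficit≤potential = ≤-trans (m≤n*m (cliqueDeficit k) 2) (m≤m+n _ (indepDeficit k))
  indepDeficit≤potential : indepDeficit k ≤ potential k
  indepDeficit≤potential = m≤n+m (indepDeficit k) (2 * cliqueDeficit k)

proposition7p5 : (m : ℕ) → ∃[ K ] ((k : ℕ) → K ≤ k → LargeClique k m × LargeIndep k m)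
proposition7p5 m = 15 * suc m , λ k k-large →
  let clique-small , indep-small = deficits-eventually-small m k k-large in
  ( cliqueSet k
  , monochromatic⇒cliqueG1 k (cliqueSet-unique k) (cliqueSet-monochromatic k)
  , deficit-small⇒length-large m (cliqueSet k) (cliqueSet-deficit k) clique-small )
  ,
  ( indepSet k
  , monochromatic⇒indepG0 k (indepSet-unique k) (indepSet-monochromatic k)
  , deficit-small⇒length-large m (indepSet k) (indepSet-deficit k) indep-small )
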